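{- Let $k$ be a positive integer. There exists an infinite family $T_k$ of binary words such that $r(w)=\Theta(n^{1/k})$ for $w\in T_k$, where $n=|w|$ (i.e. there are constants $c_1,c_2>0$ with $c_1 n^{1/k}\le r(w)\le c_2 n^{1/k}$ for all $w\in T_k$).
   Context: For a word $w$ over an ordered alphabet, $\mathrm{BWT}(w)$ is obtained by sorting the conjugates $w[i..n-1]w[0..i-1]$ ($0\le i<n$) lexicographically and concatenating their last characters; $r(w)$ is the number of maximal equal-letter runs of $\mathrm{BWT}(w)$. -}

module Defs where

open import Data.Bool using (Bool; true; false; if_then_else_)
open import Data.Nat using (ℕ; zero; suc; _+_)
open import Data.List using (List; []; _∷_; _++_; map; drop; take; length; upTo)

letter≤ : Bool → Bool → Bool
letter≤ false _     = true
letter≤ true  true  = true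
letter≤ true  false = false

lex≤ : List Bool → List Bool → Bool
lex≤ []       _        = true
lex≤ (_ ∷ _)  []       = false
lex≤ (a ∷ u)  (b ∷ v)  with letter≤ a b | letter≤ b a
... | true  | true  = lex≤ u v
... | true  | false = true
... | false | _     = false

insert : List Bool → List (List Bool) → List (List Bool)
insert u []       = u ∷ []
insert u (v ∷ vs) = if lex≤ u v then u ∷ v ∷ vs else v ∷ insert u vs

sortWords : List (List Bool) → List (List Bool)
sortWords []       = []
sortWords (u ∷ us) = insert u (sortWords us)

conjugate : List Bool → ℕ → List Bool
conjugate w i = drop i w ++ take i w

conjugates : List Bool → List (List Bool)
conjugates w = map (conjugate w) (upTo (length w))

-- Last character (conjugates of a word are nonempty, so the default is never used).
lastChar : List Bool → Bool
lastChar []           = false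
lastChar (a ∷ [])     = a
lastChar (_ ∷ b ∷ u)  = lastChar (b ∷ u)

BWT : List Bool → List Bool
BWT w = map lastChar (sortWords (conjugates w))

runsFrom : Bool → List Bool → ℕ
runsFrom _ []      = 0
runsFrom a (b ∷ u) = (if letter≤ a b then (if letter≤ b a then 0 else 1) else 1) + runsFrom b u

runs : List Bool → ℕ
runs []      = 0
runs (a ∷ u) = suc (runsFrom a u)

r : List Bool → ℕ
r w = runs (BWT w)

-- If u₁, …, uₘ are pairwise prefix-incomparable factors of w, each occurring preceded both by 0
-- and by 1, then the rotations of w beginning with uᵢ form disjoint intervals of the sorted list
-- of rotations, and each interval contains rotations ending in 0 and in 1; so the BWT has at
-- least m runs. Conversely BWT(w) is a permutation of w, whence r(w) ≤ |w| and
-- r(w) ≤ 2·|w|₁ + 1.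
-- For k = 1, doubling w into the concatenation of its two preimages under Lempel's D-morphism
-- doubles both the length (up to +2) and the number of such factors, giving r(w) ≥ |w|/6.
-- For k ≥ 2, the staircase 1 0^L 1 0^(L+1) 1 ⋯ 0^(L+s) 1 with L = s^(k-1) has the s factors
-- 0^(L+i) 1 (i < s), only s + 2 ones, and length Θ(s·L) = Θ(s^k).

module Submission where

open import Defs
open import Data.Bool using (Bool; true; false; _xor_; if_then_else_)
open import Data.Bool.Properties using (xor-assoc; xor-same; xor-identityʳ)
open import Data.Nat using (ℕ; zero; suc; _+_; _*_; _^_; _≤_; _<_; z≤n; s≤s)
open import Data.Nat.Properties
open import Data.Nat.Tactic.RingSolver using (solve-∀)
open import Data.Nat.ListAction using (sum)
open import Data.Nat.ListAction.Properties using (sum-↭; sum-++)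
open import Data.List using (List; []; _∷_; _++_; map; drop; take; length; upTo; applyUpTo; replicate; foldl)
open import Data.List.Properties using (++-assoc; ++-identityʳ; length-++; length-map; map-++; map-∘; map-upTo)
open import Data.List.Relation.Unary.All as All using (All; []; _∷_)
import Data.List.Relation.Unary.All.Properties as All
open import Data.List.Relation.Unary.Any as Any using (here; there)
open import Data.List.Relation.Unary.AllPairs as AllPairs using (AllPairs; []; _∷_)
import Data.List.Relation.Unary.AllPairs.Properties as AllPairsₚ
open import Data.List.Membership.Propositional using (_∈_)
open import Data.List.Membership.Propositional.Properties using (∈-map⁺; ∈-upTo⁺)
open import Data.List.Relation.Binary.Permutation.Propositional
  using (_↭_; ↭-refl; ↭-prep; ↭-swap; ↭-trans; ↭-sym; ↭⇒↭ₛ; module PermutationReasoning)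
open import Data.List.Relation.Binary.Permutation.Propositional.Properties
  using (All-resp-↭; ∈-resp-↭; ↭-length; ∷↭∷ʳ; map⁺)
import Data.List.Relation.Binary.Permutation.Setoid.Properties as Permutationₛ
open import Data.List.Relation.Binary.Sublist.Propositional using (_⊆_; []; _∷_; _∷ʳ_; minimum)
import Data.List.Relation.Binary.Sublist.Propositional.Properties as Sublist
open import Data.Product using (Σ; _×_; _,_; ∃-syntax; uncurry)
open import Data.Sum as Sum using (_⊎_; inj₁; inj₂; swap)
open import Relation.Nullary using (¬_; contradiction)
open import Function using (_∘_)
open import Relation.Binary.Core using (Rel)
open import Relation.Binary.Definitions using (Reflexive)
open import Relation.Binary.PropositionalEquality

∈-tail : ∀ {a} {A : Set a} {h : A} {xs zs} → All (_≢ h) zs → All (_∈ h ∷ xs) zs → All (_∈ xs) zs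
∈-tail ≢h ∈h∷xs = All.zipWith (uncurry Any.tail) (≢h , ∈h∷xs)

module _ {a ℓ} {A : Set a} {_≤_ : Rel A ℓ} (≤-refl′ : Reflexive _≤_) where

  ascending-⊆-sorted : ∀ {xs ys} → AllPairs _≤_ xs → AllPairs (λ x y → ¬ y ≤ x) ys →
                       All (_∈ xs) ys → ys ⊆ xs
  ascending-⊆-sorted {xs}     {[]}     _ _ _ = minimum xs
  ascending-⊆-sorted {h ∷ xs} {y ∷ ys} (_ ∷ sorted) (y<ys ∷ ascending) (here refl ∷ ys∈) =
    refl ∷ ascending-⊆-sorted sorted ascending
             (∈-tail (All.map (λ z≰y → λ { refl → z≰y ≤-refl′ }) y<ys) ys∈)
  ascending-⊆-sorted {h ∷ xs} {y ∷ ys} (h≤xs ∷ sorted) (y<ys ∷ ascending) (there y∈xs ∷ ys∈) =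
    h ∷ʳ ascending-⊆-sorted sorted (y<ys ∷ ascending)
           (y∈xs ∷ ∈-tail (All.map (λ z≰y → λ { refl → z≰y h≤y }) y<ys) ys∈)
    where
    h≤y : h ≤ y
    h≤y = All.lookup h≤xs y∈xs

^-distrib-* : ∀ m n k → (m * n) ^ k ≡ m ^ k * n ^ k
^-distrib-* m n zero    = refl
^-distrib-* m n (suc k) = trans (cong (m * n *_) (^-distrib-* m n k)) (interchange m n (m ^ k) (n ^ k))
  where
  interchange : ∀ a b c d → a * b * (c * d) ≡ a * c * (b * d)
  interchange = solve-∀

xor-cancelˡ : ∀ x y → x xor (x xor y) ≡ y
xor-cancelˡ x y = trans (sym (xor-assoc x x y)) (cong (_xor y) (xor-same x))

xor-cancelʳ : ∀ x y → (x xor y) xor y ≡ x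
xor-cancelʳ x y = trans (xor-assoc x y y) (trans (cong (x xor_) (xor-same y)) (xor-identityʳ x))

-- Lexicographic order and sorting

Word : Set
Word = List Bool

infix 4 _≤ˡ_ _<ˡ_

_≤ˡ_ : Word → Word → Set
u ≤ˡ v = lex≤ u v ≡ true

_<ˡ_ : Word → Word → Set
u <ˡ v = ¬ (v ≤ˡ u)

≤ˡ-refl : Reflexive _≤ˡ_
≤ˡ-refl {[]}        = refl
≤ˡ-refl {false ∷ u} = ≤ˡ-refl {u}
≤ˡ-refl {true ∷ u}  = ≤ˡ-refl {u}

≤ˡ-total : ∀ u v → lex≤ u v ≡ false → v ≤ˡ u
≤ˡ-total []          v           ()
≤ˡ-total (_ ∷ _)     []          _   = refl
≤ˡ-total (false ∷ u) (false ∷ v) u≰v = ≤ˡ-total u v u≰v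
≤ˡ-total (false ∷ u) (true ∷ v)  ()
≤ˡ-total (true ∷ u)  (false ∷ v) _   = refl
≤ˡ-total (true ∷ u)  (true ∷ v)  u≰v = ≤ˡ-total u v u≰v

≤ˡ-trans : ∀ u v w → u ≤ˡ v → v ≤ˡ w → u ≤ˡ w
≤ˡ-trans []          v           w           _   _   = refl
≤ˡ-trans (_ ∷ _)     []          w           ()  _
≤ˡ-trans (_ ∷ _)     (_ ∷ _)     []          _   ()
≤ˡ-trans (false ∷ u) (false ∷ v) (false ∷ w) u≤v v≤w = ≤ˡ-trans u v w u≤v v≤w
≤ˡ-trans (false ∷ u) (false ∷ v) (true ∷ w)  _   _   = refl
≤ˡ-trans (false ∷ u) (true ∷ v)  (false ∷ w) _   ()
≤ˡ-trans (false ∷ u) (true ∷ v)  (true ∷ w)  _   _   = refl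
≤ˡ-trans (true ∷ u)  (false ∷ v) w           ()  _
≤ˡ-trans (true ∷ u)  (true ∷ v)  (false ∷ w) _   ()
≤ˡ-trans (true ∷ u)  (true ∷ v)  (true ∷ w)  u≤v v≤w = ≤ˡ-trans u v w u≤v v≤w

≤ˡ-antisym : ∀ u v → u ≤ˡ v → v ≤ˡ u → u ≡ v
≤ˡ-antisym []          []          _   _   = refl
≤ˡ-antisym []          (_ ∷ _)     _   ()
≤ˡ-antisym (_ ∷ _)     []          ()  _
≤ˡ-antisym (false ∷ u) (false ∷ v) u≤v v≤u = cong (false ∷_) (≤ˡ-antisym u v u≤v v≤u)
≤ˡ-antisym (false ∷ u) (true ∷ v)  _   ()
≤ˡ-antisym (true ∷ u)  (false ∷ v) ()  _
≤ˡ-antisym (true ∷ u)  (true ∷ v)  u≤v v≤u = cong (true ∷_) (≤ˡ-antisym u v u≤v v≤u)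

<ˡ-connex : ∀ u v → u ≢ v → u <ˡ v ⊎ v <ˡ u
<ˡ-connex u v u≢v with lex≤ u v in u≤v
... | false = inj₂ λ ()
... | true  = inj₁ λ v≤u → u≢v (≤ˡ-antisym u v u≤v v≤u)

insert-↭ : ∀ u vs → insert u vs ↭ u ∷ vs
insert-↭ u []       = ↭-refl
insert-↭ u (v ∷ vs) with lex≤ u v
... | true  = ↭-refl
... | false = ↭-trans (↭-prep v (insert-↭ u vs)) (↭-swap v u ↭-refl)

sortWords-↭ : ∀ us → sortWords us ↭ us
sortWords-↭ []       = ↭-refl
sortWords-↭ (u ∷ us) = ↭-trans (insert-↭ u (sortWords us)) (↭-prep u (sortWords-↭ us))

insert-sorted : ∀ u vs → AllPairs _≤ˡ_ vs → AllPairs _≤ˡ_ (insert u vs)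
insert-sorted u []       _                = [] ∷ []
insert-sorted u (v ∷ vs) (v≤vs ∷ sorted) with lex≤ u v in u≤v
... | true  = (u≤v ∷ All.map (≤ˡ-trans u v _ u≤v) v≤vs) ∷ v≤vs ∷ sorted
... | false = All-resp-↭ (↭-sym (insert-↭ u vs)) (≤ˡ-total u v u≤v ∷ v≤vs)
            ∷ insert-sorted u vs sorted

sortWords-sorted : ∀ us → AllPairs _≤ˡ_ (sortWords us)
sortWords-sorted []       = []
sortWords-sorted (u ∷ us) = insert-sorted u (sortWords us) (sortWords-sorted us)

infix 4 _≺_ _#_

data _≺_ : Word → Word → Set where
  here  : ∀ {u v} → false ∷ u ≺ true ∷ v
  there : ∀ x {u v} → u ≺ v → x ∷ u ≺ x ∷ v

_#_ : Word → Word → Set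
u # v = u ≺ v ⊎ v ≺ u

#-sym : ∀ {u v} → u # v → v # u
#-sym = swap

≺-++ˡ : ∀ {u v} X → u ≺ v → u ++ X ≺ v
≺-++ˡ X here        = here
≺-++ˡ X (there x l) = there x (≺-++ˡ X l)

≺-++ʳ : ∀ {u v} Y → u ≺ v → u ≺ v ++ Y
≺-++ʳ Y here        = here
≺-++ʳ Y (there x l) = there x (≺-++ʳ Y l)

≺⇒<ˡ : ∀ {u v} → u ≺ v → u <ˡ v
≺⇒<ˡ here            = λ ()
≺⇒<ˡ (there false l) = ≺⇒<ˡ l
≺⇒<ˡ (there true l)  = ≺⇒<ˡ l

≤ˡ∧#⇒≺ : ∀ {u v} → u ≤ˡ v × u # v → u ≺ v
≤ˡ∧#⇒≺ (_   , inj₁ u≺v) = u≺v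
≤ˡ∧#⇒≺ (u≤v , inj₂ v≺u) = contradiction u≤v (≺⇒<ˡ v≺u)

sortWords-≺ : ∀ us → AllPairs _#_ us → AllPairs _≺_ (sortWords us)
sortWords-≺ us apart = AllPairs.zipWith ≤ˡ∧#⇒≺ (sortWords-sorted us , apart′)
  where
  apart′ : AllPairs _#_ (sortWords us)
  apart′ = Permutationₛ.AllPairs-resp-↭ (setoid Word) #-sym (resp₂ _#_)
             (↭⇒↭ₛ (↭-sym (sortWords-↭ us))) apart

-- Runs and the upper bounds

-- The summand of runsFrom, so that runsFrom a (b ∷ u) reduces to change a b + runsFrom b u.
change : Bool → Bool → ℕ
change a b = if letter≤ a b then (if letter≤ b a then 0 else 1) else 1

bit : Bool → ℕ
bit false = 0
bit true  = 1

ones : Word → ℕ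
ones w = sum (map bit w)

change-≢ : ∀ {a b} → a ≢ b → change a b ≡ 1
change-≢ {false} {false} a≢b = contradiction refl a≢b
change-≢ {false} {true}  _   = refl
change-≢ {true}  {false} _   = refl
change-≢ {true}  {true}  a≢b = contradiction refl a≢b

change≤1 : ∀ a b → change a b ≤ 1
change≤1 false false = z≤n
change≤1 false true  = ≤-refl
change≤1 true  false = ≤-refl
change≤1 true  true  = z≤n

change-triangle : ∀ a b c → change a c ≤ change a b + change b c
change-triangle false false c     = ≤-refl
change-triangle true  true  c     = ≤-refl
change-triangle false true  false = z≤n
change-triangle false true  true  = ≤-refl
change-triangle true  false false = ≤-refl
change-triangle true  false true  = z≤n

change≤bit+bit : ∀ a b → change a b ≤ bit a + bit b
change≤bit+bit false false = z≤n
change≤bit+bit false true  = ≤-refl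
change≤bit+bit true  false = ≤-refl
change≤bit+bit true  true  = z≤n

runsFrom-triangle : ∀ a b xs → runsFrom a xs ≤ change a b + runsFrom b xs
runsFrom-triangle a b []       = z≤n
runsFrom-triangle a b (c ∷ xs) = begin
  change a c + runsFrom c xs                ≤⟨ +-monoˡ-≤ _ (change-triangle a b c) ⟩
  change a b + change b c + runsFrom c xs   ≡⟨ +-assoc (change a b) _ _ ⟩
  change a b + (change b c + runsFrom c xs) ∎
  where open ≤-Reasoning

runsFrom-⊆ : ∀ a {xs ys} → xs ⊆ ys → runsFrom a xs ≤ runsFrom a ys
runsFrom-⊆ a []                      = z≤n
runsFrom-⊆ a (_∷ʳ_ {ys = ys} y xs⊆ys) = ≤-trans (runsFrom-⊆ a xs⊆ys) (runsFrom-triangle a y ys)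
runsFrom-⊆ a (_∷_ {x} refl xs⊆ys)     = +-monoʳ-≤ (change a x) (runsFrom-⊆ x xs⊆ys)

runs-∷ : ∀ a xs → runs xs ≤ runs (a ∷ xs)
runs-∷ a []       = z≤n
runs-∷ a (x ∷ xs) = s≤s (m≤n+m _ (change a x))

runs-⊆ : ∀ {xs ys} → xs ⊆ ys → runs xs ≤ runs ys
runs-⊆ []                      = z≤n
runs-⊆ (_∷ʳ_ {ys = ys} y xs⊆ys) = ≤-trans (runs-⊆ xs⊆ys) (runs-∷ y ys)
runs-⊆ (_∷_ {x} refl xs⊆ys)     = s≤s (runsFrom-⊆ x xs⊆ys)

runsFrom≤runs : ∀ a xs → runsFrom a xs ≤ runs xs
runsFrom≤runs a []       = z≤n
runsFrom≤runs a (x ∷ xs) = +-monoˡ-≤ _ (change≤1 a x)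

runs≤1+runsFrom : ∀ a xs → runs xs ≤ suc (runsFrom a xs)
runs≤1+runsFrom a []       = z≤n
runs≤1+runsFrom a (x ∷ xs) = s≤s (m≤n+m _ (change a x))

runs≤length : ∀ xs → runs xs ≤ length xs
runs≤length []       = z≤n
runs≤length (x ∷ xs) = s≤s (≤-trans (runsFrom≤runs x xs) (runs≤length xs))

runsFrom≤2*ones+bit : ∀ a xs → runsFrom a xs ≤ 2 * ones xs + bit a
runsFrom≤2*ones+bit a []       = z≤n
runsFrom≤2*ones+bit a (x ∷ xs) = begin
  change a x + runsFrom x xs                     ≤⟨ +-mono-≤ (change≤bit+bit a x) (runsFrom≤2*ones+bit x xs) ⟩
  (bit a + bit x) + (2 * ones xs + bit x)        ≡⟨ regroup (bit a) (bit x) (ones xs) ⟩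
  2 * (bit x + ones xs) + bit a                  ∎
  where
  open ≤-Reasoning
  regroup : ∀ a x o → (a + x) + (2 * o + x) ≡ 2 * (x + o) + a
  regroup = solve-∀

runs≤1+2*ones : ∀ xs → runs xs ≤ suc (2 * ones xs)
runs≤1+2*ones xs = begin
  runs xs                    ≤⟨ runs≤1+runsFrom false xs ⟩
  suc (runsFrom false xs)    ≤⟨ s≤s (runsFrom≤2*ones+bit false xs) ⟩
  suc (2 * ones xs + 0)      ≡⟨ cong suc (+-identityʳ (2 * ones xs)) ⟩
  suc (2 * ones xs)          ∎
  where open ≤-Reasoning

lastChar-++ : ∀ xs y ys → lastChar (xs ++ y ∷ ys) ≡ lastChar (y ∷ ys)
lastChar-++ []           y ys = refl
lastChar-++ (_ ∷ [])     y ys = refl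
lastChar-++ (_ ∷ x ∷ xs) y ys = lastChar-++ (x ∷ xs) y ys

applyUpTo-lastChar-take : ∀ x w (f : ℕ → Bool) → (∀ i → f i ≡ lastChar (x ∷ take i w)) →
                          applyUpTo f (length w) ++ lastChar (x ∷ w) ∷ [] ≡ x ∷ w
applyUpTo-lastChar-take x []      f f≗ = refl
applyUpTo-lastChar-take x (y ∷ w) f f≗ =
  cong₂ _∷_ (f≗ 0) (applyUpTo-lastChar-take y w (f ∘ suc) (f≗ ∘ suc))

lastChars-conjugates : ∀ x w → map lastChar (conjugates (x ∷ w))
                     ≡ lastChar (x ∷ w) ∷ applyUpTo (lastChar ∘ conjugate (x ∷ w) ∘ suc) (length w)
lastChars-conjugates x w = begin
  map lastChar (map (conjugate v) (upTo (suc n)))  ≡⟨ map-∘ (upTo (suc n)) ⟨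
  map (lastChar ∘ conjugate v) (upTo (suc n))      ≡⟨ map-upTo (lastChar ∘ conjugate v) (suc n) ⟩
  applyUpTo (lastChar ∘ conjugate v) (suc n)       ≡⟨ cong (λ u → lastChar u ∷ rotated) (++-identityʳ v) ⟩
  lastChar v ∷ rotated                             ∎
  where
  open ≡-Reasoning
  v : Word
  v = x ∷ w
  n : ℕ
  n = length w
  rotated : Word
  rotated = applyUpTo (lastChar ∘ conjugate v ∘ suc) n

BWT-↭ : ∀ w → BWT w ↭ w
BWT-↭ []      = ↭-refl
BWT-↭ (x ∷ w) = begin
  map lastChar (sortWords (conjugates v))  ↭⟨ map⁺ lastChar (sortWords-↭ (conjugates v)) ⟩
  map lastChar (conjugates v)              ≡⟨ lastChars-conjugates x w ⟩
  lastChar v ∷ rotated                     ↭⟨ ∷↭∷ʳ (lastChar v) rotated ⟩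
  rotated ++ lastChar v ∷ []               ≡⟨ applyUpTo-lastChar-take x w _ lastChar-rotation ⟩
  v                                        ∎
  where
  open PermutationReasoning
  v : Word
  v = x ∷ w
  rotated : Word
  rotated = applyUpTo (lastChar ∘ conjugate v ∘ suc) (length w)
  lastChar-rotation : ∀ i → lastChar (drop i w ++ x ∷ take i w) ≡ lastChar (x ∷ take i w)
  lastChar-rotation i = lastChar-++ (drop i w) x (take i w)

r≤length : ∀ w → r w ≤ length w
r≤length w = ≤-trans (runs≤length (BWT w)) (≤-reflexive (↭-length (BWT-↭ w)))

r≤1+2*ones : ∀ w → r w ≤ suc (2 * ones w)
r≤1+2*ones w = begin
  runs (BWT w)             ≤⟨ runs≤1+2*ones (BWT w) ⟩
  suc (2 * ones (BWT w))   ≡⟨ cong (λ n → suc (2 * n)) (sum-↭ (map⁺ bit (BWT-↭ w))) ⟩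
  suc (2 * ones w)         ∎
  where open ≤-Reasoning

-- Left special factors and the lower bound

Factor : Word → Word → Set
Factor v w = ∃[ pre ] ∃[ post ] w ≡ pre ++ v ++ post

LeftSpecial : Word → Word → Set
LeftSpecial w u = u ≢ [] × (∀ c → Factor (c ∷ u) w)

drop-++-∷ : ∀ pre (c : Bool) t → drop (suc (length pre)) (pre ++ c ∷ t) ≡ t
drop-++-∷ []        c t = refl
drop-++-∷ (_ ∷ pre) c t = drop-++-∷ pre c t

take-++-∷ : ∀ pre (c : Bool) t → take (suc (length pre)) (pre ++ c ∷ t) ≡ pre ++ c ∷ []
take-++-∷ []        c t = refl
take-++-∷ (x ∷ pre) c t = cong (x ∷_) (take-++-∷ pre c t)

1+length<length-++-∷-∷ : ∀ pre (c x : Bool) t → suc (length pre) < length (pre ++ c ∷ x ∷ t)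
1+length<length-++-∷-∷ []        c x t = s≤s (s≤s z≤n)
1+length<length-++-∷-∷ (_ ∷ pre) c x t = s≤s (1+length<length-++-∷-∷ pre c x t)

factor⇒conjugate : ∀ {c u w} → u ≢ [] → Factor (c ∷ u) w →
                   ∃[ X ] (u ++ X ∈ conjugates w × lastChar (u ++ X) ≡ c)
factor⇒conjugate {c} {[]}    u≢[] _                  = contradiction refl u≢[]
factor⇒conjugate {c} {x ∷ v} _    (pre , post , refl) = post ++ pre ++ c ∷ [] , ∈conjugates , ends-with-c
  where
  u w : Word
  u = x ∷ v
  w = pre ++ c ∷ u ++ post
  rotation : conjugate w (suc (length pre)) ≡ u ++ post ++ pre ++ c ∷ []
  rotation = trans (cong₂ _++_ (drop-++-∷ pre c (u ++ post)) (take-++-∷ pre c (u ++ post)))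
                   (++-assoc u post (pre ++ c ∷ []))
  ∈conjugates : u ++ post ++ pre ++ c ∷ [] ∈ conjugates w
  ∈conjugates = subst (_∈ conjugates w) rotation
                  (∈-map⁺ (conjugate w) (∈-upTo⁺ (1+length<length-++-∷-∷ pre c x (v ++ post))))
  ends-with-c : lastChar (u ++ post ++ pre ++ c ∷ []) ≡ c
  ends-with-c = begin
    lastChar (u ++ post ++ pre ++ c ∷ [])     ≡⟨ cong lastChar (++-assoc u post _) ⟨
    lastChar ((u ++ post) ++ pre ++ c ∷ [])   ≡⟨ cong lastChar (++-assoc (u ++ post) pre _) ⟨
    lastChar (((u ++ post) ++ pre) ++ c ∷ []) ≡⟨ lastChar-++ ((u ++ post) ++ pre) c [] ⟩
    c                                         ∎
    where open ≡-Reasoning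

Factor-++ˡ : ∀ {v w} x → Factor v w → Factor v (x ++ w)
Factor-++ˡ {v} x (pre , post , refl) = x ++ pre , post , sym (++-assoc x pre (v ++ post))

Factor-++ʳ : ∀ {v w} y → Factor v w → Factor v (w ++ y)
Factor-++ʳ {v} y (pre , post , refl) = pre , post ++ y ,
  trans (++-assoc pre (v ++ post) y) (cong (pre ++_) (++-assoc v post y))

record RowPair (w u : Word) : Set where
  field
    low high  : Word
    low∈      : u ++ low ∈ conjugates w
    high∈     : u ++ high ∈ conjugates w
    low<high  : u ++ low <ˡ u ++ high
    lastChar≢ : lastChar (u ++ low) ≢ lastChar (u ++ high)

rowPair : ∀ {w u X Y} → u ++ X ∈ conjugates w → u ++ Y ∈ conjugates w →
          lastChar (u ++ X) ≢ lastChar (u ++ Y) → RowPair w u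
rowPair {u = u} {X} {Y} X∈ Y∈ X≢Y with <ˡ-connex (u ++ X) (u ++ Y) (X≢Y ∘ cong lastChar)
... | inj₁ X<Y = record { low∈ = X∈ ; high∈ = Y∈ ; low<high = X<Y ; lastChar≢ = X≢Y }
... | inj₂ Y<X = record { low∈ = Y∈ ; high∈ = X∈ ; low<high = Y<X ; lastChar≢ = X≢Y ∘ sym }

leftSpecial⇒rowPair : ∀ {w u} → LeftSpecial w u → RowPair w u
leftSpecial⇒rowPair (u≢[] , factor)
  with factor⇒conjugate u≢[] (factor false) | factor⇒conjugate u≢[] (factor true)
... | _ , X∈ , X↦false | _ , Y∈ , Y↦true = rowPair X∈ Y∈ (subst₂ _≢_ (sym X↦false) (sym Y↦true) λ ())

rows : ∀ {w us} → All (RowPair w) us → List Word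
rows {us = []}     []       = []
rows {us = u ∷ us} (p ∷ ps) = (u ++ RowPair.low p) ∷ (u ++ RowPair.high p) ∷ rows ps

rows-∈ : ∀ {w us} (ps : All (RowPair w) us) → All (_∈ conjugates w) (rows ps)
rows-∈ []       = []
rows-∈ (p ∷ ps) = RowPair.low∈ p ∷ RowPair.high∈ p ∷ rows-∈ ps

rows-≻ : ∀ {w v us} (ps : All (RowPair w) us) → All (v ≺_) us → All (v ≺_) (rows ps)
rows-≻ []       []           = []
rows-≻ (p ∷ ps) (v≺u ∷ v≺us) =
  ≺-++ʳ (RowPair.low p) v≺u ∷ ≺-++ʳ (RowPair.high p) v≺u ∷ rows-≻ ps v≺us

rows-ascending : ∀ {w us} (ps : All (RowPair w) us) → AllPairs _≺_ us → AllPairs _<ˡ_ (rows ps)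
rows-ascending []       []             = []
rows-ascending (p ∷ ps) (u≺us ∷ ≺-us) =
  (low<high ∷ below low) ∷ below high ∷ rows-ascending ps ≺-us
  where
  open RowPair p
  below : ∀ X → All (_ ++ X <ˡ_) (rows ps)
  below X = All.map (≺⇒<ˡ ∘ ≺-++ˡ X) (rows-≻ ps u≺us)

rows-runs : ∀ {w us} (ps : All (RowPair w) us) a → length us ≤ runsFrom a (map lastChar (rows ps))
rows-runs []                     a = z≤n
rows-runs {us = u ∷ us} (p ∷ ps) a = begin
  suc (length us)                 ≤⟨ s≤s (rows-runs ps hi) ⟩
  suc (runsFrom hi rest)          ≡⟨ cong (_+ runsFrom hi rest) (change-≢ lastChar≢) ⟨
  change lo hi + runsFrom hi rest ≤⟨ m≤n+m _ (change a lo) ⟩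
  runsFrom a (lo ∷ hi ∷ rest)     ∎
  where
  open RowPair p
  open ≤-Reasoning
  lo hi : Bool
  lo = lastChar (u ++ low)
  hi = lastChar (u ++ high)
  rest : Word
  rest = map lastChar (rows ps)

length≤r : ∀ {w us} → AllPairs _#_ us → All (LeftSpecial w) us → length us ≤ r w
length≤r {w} {us} apart special = begin
  length us                                  ≡⟨ ↭-length (sortWords-↭ us) ⟨
  length (sortWords us)                      ≤⟨ rows-runs pairs false ⟩
  runsFrom false (map lastChar (rows pairs)) ≤⟨ runsFrom≤runs false _ ⟩
  runs (map lastChar (rows pairs))           ≤⟨ runs-⊆ (Sublist.map⁺ lastChar rows⊆) ⟩
  r w                                        ∎
  where
  open ≤-Reasoning
  pairs : All (RowPair w) (sortWords us)
  pairs = All.map leftSpecial⇒rowPair (All-resp-↭ (↭-sym (sortWords-↭ us)) special)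
  rows⊆ : rows pairs ⊆ sortWords (conjugates w)
  rows⊆ = ascending-⊆-sorted (λ {u} → ≤ˡ-refl {u}) (sortWords-sorted (conjugates w))
            (rows-ascending pairs (sortWords-≺ us apart))
            (All.map (∈-resp-↭ (↭-sym (sortWords-↭ (conjugates w)))) (rows-∈ pairs))

-- The family for k = 1

integrate : Bool → Word → Word
integrate t []      = t ∷ []
integrate t (c ∷ w) = t ∷ integrate (t xor c) w

parity : Bool → Word → Bool
parity = foldl _xor_

length-integrate : ∀ t w → length (integrate t w) ≡ suc (length w)
length-integrate t []      = refl
length-integrate t (c ∷ w) = cong suc (length-integrate (t xor c) w)

integrate-++ : ∀ t u v → ∃[ B ] integrate t (u ++ v) ≡ integrate t u ++ B
integrate-++ t []      []      = [] , refl
integrate-++ t []      (c ∷ v) = integrate (t xor c) v , refl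
integrate-++ t (c ∷ u) v       with integrate-++ (t xor c) u v
... | B , eq = B , cong (t ∷_) eq

++-integrate : ∀ t u v → ∃[ A ] integrate t (u ++ v) ≡ A ++ integrate (parity t u) v
++-integrate t []      v = [] , refl
++-integrate t (c ∷ u) v with ++-integrate (t xor c) u v
... | A , eq = t ∷ A , cong (t ∷_) eq

parity-surjective : ∀ u p → ∃[ t ] parity t u ≡ p
parity-surjective []      p = p , refl
parity-surjective (c ∷ u) p with parity-surjective u p
... | t , eq = t xor c , trans (cong (λ s → parity s u) (xor-cancelʳ t c)) eq

integrate-factor : ∀ {c u w} p → Factor (c ∷ u) w →
                   ∃[ t ] Factor (p ∷ integrate (p xor c) u) (integrate t w)
integrate-factor {c} {u} p (pre , post , refl) with parity-surjective pre p
... | t , refl with ++-integrate t pre (c ∷ u ++ post) | integrate-++ (parity t pre xor c) u post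
...   | A , eq₁ | B , eq₂ = t , A , B , trans eq₁ (cong (λ v → A ++ parity t pre ∷ v) eq₂)

-- The two preimages of w under Lempel's D-morphism (xᵢ)ᵢ ↦ (xᵢ xor xᵢ₊₁)ᵢ.
double : Word → Word
double w = integrate false w ++ integrate true w

integrate-≢[] : ∀ t u → integrate t u ≢ []
integrate-≢[] t []      ()
integrate-≢[] t (_ ∷ _) ()

leftSpecial-double : ∀ {w u} q → LeftSpecial w u → LeftSpecial (double w) (integrate q u)
leftSpecial-double {w} {u} q (_ , factor) = integrate-≢[] q u , factor′
  where
  cancel : ∀ {p v} → Factor (p ∷ integrate (p xor (p xor q)) u) v → Factor (p ∷ integrate q u) v
  cancel {p} = subst (λ t → Factor (p ∷ integrate t u) _) (xor-cancelˡ p q)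
  factor′ : ∀ p → Factor (p ∷ integrate q u) (double w)
  factor′ p with integrate-factor p (factor (p xor q))
  ... | false , occurrence = Factor-++ʳ (integrate true w) (cancel occurrence)
  ... | true  , occurrence = Factor-++ˡ (integrate false w) (cancel occurrence)

integrate-false≺true : ∀ u v → integrate false u ≺ integrate true v
integrate-false≺true []      []      = here
integrate-false≺true []      (_ ∷ _) = here
integrate-false≺true (_ ∷ _) []      = here
integrate-false≺true (_ ∷ _) (_ ∷ _) = here

≺-integrate : ∀ {u v} q → u ≺ v → integrate q u # integrate q v
≺-integrate {false ∷ u} {true ∷ v} false here = inj₁ (there false (integrate-false≺true u v))
≺-integrate {false ∷ u} {true ∷ v} true  here = inj₂ (there true (integrate-false≺true v u))
≺-integrate q (there x u≺v) = Sum.map (there q) (there q) (≺-integrate (q xor x) u≺v)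

#-integrate : ∀ {u v} q → u # v → integrate q u # integrate q v
#-integrate q (inj₁ u≺v) = ≺-integrate q u≺v
#-integrate q (inj₂ v≺u) = #-sym (≺-integrate q v≺u)

lempel : ℕ → Word
lempel zero    = false ∷ false ∷ true ∷ false ∷ []
lempel (suc l) = double (lempel l)

lempelSpecials : ℕ → List Word
lempelSpecials zero    = (false ∷ []) ∷ []
lempelSpecials (suc l) = map (integrate false) (lempelSpecials l) ++ map (integrate true) (lempelSpecials l)

lempelSpecials-leftSpecial : ∀ l → All (LeftSpecial (lempel l)) (lempelSpecials l)
lempelSpecials-leftSpecial zero    = ((λ ()) , λ { false → [] , true ∷ false ∷ [] , refl
                                                 ; true → false ∷ false ∷ [] , [] , refl }) ∷ []
lempelSpecials-leftSpecial (suc l) = All.++⁺ (All.map⁺ (All.map (leftSpecial-double false) special))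
                                             (All.map⁺ (All.map (leftSpecial-double true) special))
  where
  special : All (LeftSpecial (lempel l)) (lempelSpecials l)
  special = lempelSpecials-leftSpecial l

lempelSpecials-apart : ∀ l → AllPairs _#_ (lempelSpecials l)
lempelSpecials-apart zero    = [] ∷ []
lempelSpecials-apart (suc l) = AllPairsₚ.++⁺ (AllPairsₚ.map⁺ (AllPairs.map (#-integrate false) apart))
                                             (AllPairsₚ.map⁺ (AllPairs.map (#-integrate true) apart))
                                             across
  where
  specials : List Word
  specials = lempelSpecials l
  apart : AllPairs _#_ specials
  apart = lempelSpecials-apart l
  across : All (λ u → All (u #_) (map (integrate true) specials)) (map (integrate false) specials)
  across = All.map⁺ (All.universal (λ u → All.map⁺ (All.universal (inj₁ ∘ integrate-false≺true u) specials))
                                   specials)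

length-lempelSpecials : ∀ l → length (lempelSpecials l) ≡ 2 ^ l
length-lempelSpecials zero    = refl
length-lempelSpecials (suc l) = begin
  length (map (integrate false) specials ++ map (integrate true) specials)
    ≡⟨ length-++ (map (integrate false) specials) ⟩
  length (map (integrate false) specials) + length (map (integrate true) specials)
    ≡⟨ cong₂ _+_ (length-map (integrate false) specials) (length-map (integrate true) specials) ⟩
  length specials + length specials
    ≡⟨ cong (λ n → n + n) (length-lempelSpecials l) ⟩
  2 ^ l + 2 ^ l
    ≡⟨ cong (2 ^ l +_) (+-identityʳ (2 ^ l)) ⟨
  2 ^ suc l
    ∎
  where
  open ≡-Reasoning
  specials : List Word
  specials = lempelSpecials l

length-double : ∀ w → length (double w) ≡ suc (length w) + suc (length w)
length-double w =
  trans (length-++ (integrate false w)) (cong₂ _+_ (length-integrate false w) (length-integrate true w))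

length-lempel : ∀ l → length (lempel l) + 2 ≡ 6 * 2 ^ l
length-lempel zero    = refl
length-lempel (suc l) = begin
  length (double w) + 2               ≡⟨ cong (_+ 2) (length-double w) ⟩
  suc (length w) + suc (length w) + 2 ≡⟨ regroup (length w) ⟩
  2 * (length w + 2)                  ≡⟨ cong (2 *_) (length-lempel l) ⟩
  2 * (6 * 2 ^ l)                     ≡⟨ swap-factors (2 ^ l) ⟩
  6 * 2 ^ suc l                       ∎
  where
  open ≡-Reasoning
  w : Word
  w = lempel l
  regroup : ∀ n → suc n + suc n + 2 ≡ 2 * (n + 2)
  regroup = solve-∀
  swap-factors : ∀ x → 2 * (6 * x) ≡ 6 * (2 * x)
  swap-factors = solve-∀

l≤length-lempel : ∀ l → l ≤ length (lempel l)
l≤length-lempel zero    = z≤n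
l≤length-lempel (suc l) = begin
  suc l                                             ≤⟨ s≤s (l≤length-lempel l) ⟩
  suc (length (lempel l))                           ≤⟨ m≤m+n _ _ ⟩
  suc (length (lempel l)) + suc (length (lempel l)) ≡⟨ length-double (lempel l) ⟨
  length (lempel (suc l))                           ∎
  where open ≤-Reasoning

length-lempel≤6*r : ∀ l → length (lempel l) ≤ 6 * r (lempel l)
length-lempel≤6*r l = begin
  length (lempel l)             ≤⟨ m≤m+n _ 2 ⟩
  length (lempel l) + 2         ≡⟨ length-lempel l ⟩
  6 * 2 ^ l                     ≡⟨ cong (6 *_) (length-lempelSpecials l) ⟨
  6 * length (lempelSpecials l) ≤⟨ *-monoʳ-≤ 6 (length≤r (lempelSpecials-apart l)
                                                           (lempelSpecials-leftSpecial l)) ⟩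
  6 * r (lempel l)              ∎
  where open ≤-Reasoning

-- The family for k ≥ 2

ones-++ : ∀ xs ys → ones (xs ++ ys) ≡ ones xs + ones ys
ones-++ xs ys = trans (cong sum (map-++ bit xs ys)) (sum-++ (map bit xs) (map bit ys))

block : ℕ → Word
block m = replicate m false ++ true ∷ []

steps : ℕ → ℕ → Word
steps m zero    = []
steps m (suc n) = block m ++ steps (suc m) n

staircase : ℕ → ℕ → Word
staircase m n = true ∷ steps m (suc n)

blocks : ℕ → ℕ → List Word
blocks m zero    = []
blocks m (suc n) = block m ∷ blocks (suc m) n

block-≢[] : ∀ m → block m ≢ []
block-≢[] zero    ()
block-≢[] (suc m) ()

leftSpecial-++ˡ : ∀ {w u} x → LeftSpecial w u → LeftSpecial (x ++ w) u
leftSpecial-++ˡ x (u≢[] , factor) = u≢[] , Factor-++ˡ x ∘ factor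

blocks-leftSpecial : ∀ m n → All (LeftSpecial (staircase m n)) (blocks m n)
blocks-leftSpecial m zero    = []
blocks-leftSpecial m (suc n) =
  (block-≢[] m , factor) ∷ All.map shift (blocks-leftSpecial (suc m) n)
  where
  -- block (suc m) reduces to false ∷ block m.
  factor : ∀ c → Factor (c ∷ block m) (staircase m (suc n))
  factor false = true ∷ block m , steps (suc (suc m)) n , refl
  factor true  = [] , steps (suc m) (suc n) , refl
  regroup : staircase m (suc n) ≡ (true ∷ replicate m false) ++ staircase (suc m) n
  regroup = cong (true ∷_) (++-assoc (replicate m false) (true ∷ []) (steps (suc m) (suc n)))
  shift : ∀ {u} → LeftSpecial (staircase (suc m) n) u → LeftSpecial (staircase m (suc n)) u
  shift {u} = subst (λ w → LeftSpecial w u) (sym regroup) ∘ leftSpecial-++ˡ (true ∷ replicate m false)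

block-≺ : ∀ {a b} → a < b → block b ≺ block a
block-≺ {zero}  {suc b} _         = here
block-≺ {suc a} {suc b} (s≤s a<b) = there false (block-≺ a<b)

blocks-≺ : ∀ {a} m n → a < m → All (_≺ block a) (blocks m n)
blocks-≺ m zero    _   = []
blocks-≺ m (suc n) a<m = block-≺ a<m ∷ blocks-≺ (suc m) n (m<n⇒m<1+n a<m)

blocks-apart : ∀ m n → AllPairs _#_ (blocks m n)
blocks-apart m zero    = []
blocks-apart m (suc n) = All.map inj₂ (blocks-≺ (suc m) n ≤-refl) ∷ blocks-apart (suc m) n

length-blocks : ∀ m n → length (blocks m n) ≡ n
length-blocks m zero    = refl
length-blocks m (suc n) = cong suc (length-blocks (suc m) n)

n≤r-staircase : ∀ m n → n ≤ r (staircase m n)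
n≤r-staircase m n = subst (_≤ r (staircase m n)) (length-blocks m n)
                      (length≤r (blocks-apart m n) (blocks-leftSpecial m n))

ones-block : ∀ m → ones (block m) ≡ 1
ones-block zero    = refl
ones-block (suc m) = ones-block m

ones-steps : ∀ m n → ones (steps m n) ≡ n
ones-steps m zero    = refl
ones-steps m (suc n) =
  trans (ones-++ (block m) (steps (suc m) n)) (cong₂ _+_ (ones-block m) (ones-steps (suc m) n))

length-block : ∀ m → length (block m) ≡ suc m
length-block zero    = refl
length-block (suc m) = cong suc (length-block m)

length-steps-suc : ∀ m n → length (steps m (suc n)) ≡ suc m + length (steps (suc m) n)
length-steps-suc m n = trans (length-++ (block m)) (cong (_+ length (steps (suc m) n)) (length-block m))

n*m≤length-steps : ∀ m n → n * m ≤ length (steps m n)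
n*m≤length-steps m zero    = z≤n
n*m≤length-steps m (suc n) = begin
  m + n * m                         ≤⟨ +-mono-≤ (n≤1+n m) (*-monoʳ-≤ n (n≤1+n m)) ⟩
  suc m + n * suc m                 ≤⟨ +-monoʳ-≤ (suc m) (n*m≤length-steps (suc m) n) ⟩
  suc m + length (steps (suc m) n)  ≡⟨ length-steps-suc m n ⟨
  length (steps m (suc n))          ∎
  where open ≤-Reasoning

length-steps≤ : ∀ m n → length (steps m n) ≤ n * (m + n)
length-steps≤ m zero    = z≤n
length-steps≤ m (suc n) = begin
  length (steps m (suc n))          ≡⟨ length-steps-suc m n ⟩
  suc m + length (steps (suc m) n)  ≤⟨ +-mono-≤ (s≤s (m≤m+n m n)) (length-steps≤ (suc m) n) ⟩
  suc (m + n) + n * (suc m + n)     ≡⟨ cong (λ k → k + n * k) (sym (+-suc m n)) ⟩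
  (m + suc n) + n * (m + suc n)     ∎
  where open ≤-Reasoning

n≤length-steps : ∀ m n → n ≤ length (steps m n)
n≤length-steps m zero    = z≤n
n≤length-steps m (suc n) = begin
  suc n                              ≤⟨ s≤s (n≤length-steps (suc m) n) ⟩
  suc (length (steps (suc m) n))     ≤⟨ s≤s (m≤n+m _ m) ⟩
  suc m + length (steps (suc m) n)   ≡⟨ length-steps-suc m n ⟨
  length (steps m (suc n))           ∎
  where open ≤-Reasoning

n<length-staircase : ∀ m n → n < length (staircase m n)
n<length-staircase m n = s≤s (≤-trans (n≤1+n n) (n≤length-steps m (suc n)))

n*m≤length-staircase : ∀ m n → n * m ≤ length (staircase m n)
n*m≤length-staircase m n = ≤-trans (*-monoˡ-≤ m (n≤1+n n)) (≤-trans (n*m≤length-steps m (suc n)) (n≤1+n _))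

length-staircase≤7*n*m : ∀ {m n} → 1 ≤ n → n ≤ m → length (staircase m n) ≤ 7 * (n * m)
length-staircase≤7*n*m {m} {n} 1≤n n≤m = begin
  suc (length (steps m (suc n)))    ≤⟨ s≤s (length-steps≤ m (suc n)) ⟩
  1 + suc n * (m + suc n)           ≤⟨ +-mono-≤ (*-mono-≤ 1≤n 1≤m) (*-mono-≤ 1+n≤n+n m+1+n≤3m) ⟩
  n * m + (n + n) * (m + (m + m))   ≡⟨ collect n m ⟩
  7 * (n * m)                       ∎
  where
  open ≤-Reasoning
  1≤m : 1 ≤ m
  1≤m = ≤-trans 1≤n n≤m
  1+n≤n+n : 1 + n ≤ n + n
  1+n≤n+n = +-monoˡ-≤ n 1≤n
  m+1+n≤3m : m + (1 + n) ≤ m + (m + m)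
  m+1+n≤3m = +-monoʳ-≤ m (+-mono-≤ 1≤m n≤m)
  collect : ∀ n m → n * m + (n + n) * (m + (m + m)) ≡ 7 * (n * m)
  collect = solve-∀

r-staircase≤7*n : ∀ m {n} → 1 ≤ n → r (staircase m n) ≤ 7 * n
r-staircase≤7*n m {suc t} _ = begin
  r (staircase m (suc t))                ≤⟨ r≤1+2*ones (staircase m (suc t)) ⟩
  suc (2 * ones (staircase m (suc t)))   ≡⟨ cong (λ o → suc (2 * suc o)) (ones-steps m (2 + t)) ⟩
  suc (2 * (2 + suc t))                  ≤⟨ m≤m+n _ (5 * t) ⟩
  suc (2 * (2 + suc t)) + 5 * t          ≡⟨ collect t ⟩
  7 * suc t                              ∎
  where
  open ≤-Reasoning
  collect : ∀ t → suc (2 * (2 + suc t)) + 5 * t ≡ 7 * suc t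
  collect = solve-∀

lempel-bounds : ∀ l → (length (lempel l) ≤ 6 * r (lempel l) ^ 1)
                    × (r (lempel l) ^ 1 ≤ 1 * length (lempel l))
lempel-bounds l =
  subst (λ x → length (lempel l) ≤ 6 * x) (sym (^-identityʳ (r (lempel l)))) (length-lempel≤6*r l) ,
  subst₂ _≤_ (sym (^-identityʳ (r (lempel l)))) (sym (*-identityˡ (length (lempel l)))) (r≤length (lempel l))

staircase-bounds : ∀ j t → let k = 2 + j; W = staircase (suc t ^ suc j) (suc t) in
                   (length W ≤ 7 * r W ^ k) × (r W ^ k ≤ suc (7 ^ k) * length W)
staircase-bounds j t = upper , lower
  where
  open ≤-Reasoning
  k s L : ℕ
  k = 2 + j
  s = suc t
  L = s ^ suc j
  W : Word
  W = staircase L s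
  s≤L : s ≤ L
  s≤L = ≤-trans (≤-reflexive (sym (*-identityʳ s))) (*-monoʳ-≤ s (m^n>0 s j))
  upper : length W ≤ 7 * r W ^ k
  upper = begin
    length W    ≤⟨ length-staircase≤7*n*m (s≤s z≤n) s≤L ⟩
    7 * s ^ k   ≤⟨ *-monoʳ-≤ 7 (^-monoˡ-≤ k (n≤r-staircase L s)) ⟩
    7 * r W ^ k ∎
  lower : r W ^ k ≤ suc (7 ^ k) * length W
  lower = begin
    r W ^ k                   ≤⟨ ^-monoˡ-≤ k (r-staircase≤7*n L (s≤s z≤n)) ⟩
    (7 * s) ^ k               ≡⟨ ^-distrib-* 7 s k ⟩
    7 ^ k * s ^ k             ≤⟨ *-monoʳ-≤ (7 ^ k) (n*m≤length-staircase L s) ⟩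
    7 ^ k * length W          ≤⟨ m≤n+m _ (length W) ⟩
    suc (7 ^ k) * length W    ∎

proposition6 : (k : ℕ) → 1 ≤ k →
    Σ (List Bool → Set) λ T →
      ((m : ℕ) → ∃[ w ] (T w × m ≤ length w))
      × ∃[ a ] ∃[ c ] ((w : List Bool) → T w →
          (length w ≤ suc a * r w ^ k) × (r w ^ k ≤ suc c * length w))
proposition6 zero ()
proposition6 (suc zero) _ =
  (λ w → ∃[ l ] w ≡ lempel l) ,
  (λ m → lempel m , (m , refl) , l≤length-lempel m) ,
  5 , 0 , λ { _ (l , refl) → lempel-bounds l }
proposition6 (suc (suc j)) _ =
  (λ w → ∃[ t ] w ≡ staircase (suc t ^ suc j) (suc t)) ,
  (λ m → _ , (m , refl) , ≤-trans (n≤1+n m) (<⇒≤ (n<length-staircase (suc m ^ suc j) (suc m)))) ,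
  6 , 7 ^ (2 + j) , λ { _ (t , refl) → staircase-bounds j t }
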